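{- Let $G$ be an $N$-player partizan game. Then $G\le_L 0$ if and only if Left does not have a winning strategy in $G$ when Left moves first.
   Context: An $N$-player partizan game ($N\ge2$) is an ordered $N$-tuple $(\mathscr G^{C_0},\dots,\mathscr G^{C_{N-1}})$ of finite sets of partizan games (no infinite runs); players Left $=C_0$, $C_1,\dots,C_{N-2}$, Right $=C_{N-1}$ move cyclically (Left after Right), $\mathscr G^{C_i}$ being the options for $C_i$. Under normal play, a player with no option on their turn is the unique loser and all others win. $0$ is the game with no options. The disjunctive sum $G+H$ has $C_i$-options $G^{C_i}+H$ and $G+H^{C_i}$. "Left has a winning strategy in $G$ moving $i$th" ($1\le i\le N$) means that when play starts with the player for whom Left is $i$th to move, Left can guarantee not being the loser. $G\le_L H$ means: for every game $X$ and every $1\le i\le N$, if Left has a winning strategy in $G+X$ moving $i$th then Left has a winning strategy in $H+X$ moving $i$th. -}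

module Defs where

open import Data.Nat using (ℕ; zero; suc; _+_; _∸_; _≤_; _%_)
open import Data.Nat.DivMod using (m%n<n)
open import Data.Fin using (Fin; zero; suc; toℕ; fromℕ<; splitAt)
open import Data.Sum using ([_,_]′)
open import Data.Product using (Σ)
open import Data.Empty using (⊥)

-- Players are indexed by Fin N:
-- player zero is Left (C_0), player (N-1) is Right (C_{N-1}). Inductivity = no infinite runs.
data Game (N : ℕ) : Set where
  mk : (n : Fin N → ℕ) → ((i : Fin N) → Fin (n i) → Game N) → Game N

zeroG : {N : ℕ} → Game N
zeroG = mk (λ _ → 0) (λ _ ())

infixl 6 _⊕_
_⊕_ : {N : ℕ} → Game N → Game N → Game N
mk n f ⊕ mk m g =
  mk (λ i → n i + m i)
     (λ i k → [ (λ a → f i a ⊕ mk m g) , (λ b → mk n f ⊕ g i b) ]′ (splitAt (n i) k))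

next : {N : ℕ} → Fin N → Fin N
next {suc n} p = fromℕ< (m%n<n (suc (toℕ p)) (suc n))

-- LeftWins G p : with player p to move in G, Left has a strategy
-- guaranteeing that Left is not the loser (normal play: the unique
-- loser is the player unable to move on their turn).
LeftWins : {N : ℕ} → Game N → Fin N → Set
LeftWins (mk n f) zero    = Σ (Fin (n zero)) (λ k → LeftWins (f zero k) (next zero))
LeftWins (mk n f) (suc q) = (k : Fin (n (suc q))) → LeftWins (f (suc q) k) (next (suc q))

-- "Left has a winning strategy in G moving i-th" (1 ≤ i ≤ N):
-- play starts with player C_{(N + 1 - i) mod N}, so that Left is the
-- i-th player to move.
LeftWinsMoving : {N : ℕ} → Game N → ℕ → Set
LeftWinsMoving {zero}  G i = ⊥
LeftWinsMoving {suc n} G i =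
  LeftWins G (fromℕ< (m%n<n (suc n + 1 ∸ i) (suc n)))

_≤L_ : {N : ℕ} → Game N → Game N → Set
_≤L_ {N} G H = (X : Game N) (i : ℕ) → 1 ≤ i → i ≤ N →
  LeftWinsMoving (G ⊕ X) i → LeftWinsMoving (H ⊕ X) i

module Submission where

-- (⇒) If Left could win G moving first, then (adding the neutral game 0)
-- Left would win G + 0 moving first, hence, by G ≤_L 0, also 0 + 0 moving
-- first — but there Left has no move at all.
--
-- (⇐) The heart of the proof is an absorption principle: if Left cannot win
-- G moving first, then for every game X and every player p to move,
-- Left winning G + X implies Left winning X.  It is proved by induction on
-- G and X, simultaneously with a companion statement for positions where
-- Left cannot win G with some opponent to move: an opponent then has a move
-- in G that refutes Left, and following it shows Left wins X moving first.
-- Finally X is turned back into 0 + X.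
--
-- The hypothesis
-- 2 ≤ N is only used to exclude N = 0; the argument works for N ≥ 1.

open import Defs
open import Data.Nat using (ℕ; zero; suc; _+_; _∸_; _%_; _≤_; s≤s; z≤n)
open import Data.Nat.DivMod using (m%n<n; n%n≡0)
open import Data.Nat.Properties using (+-comm)
open import Data.Fin using (Fin; zero; suc; toℕ; fromℕ<; splitAt; _↑ˡ_; _↑ʳ_)
open import Data.Fin.Properties
  using (splitAt-↑ˡ; splitAt-↑ʳ; ¬∀⟶∃¬; any?; all?; toℕ-injective; toℕ-fromℕ<)
open import Data.Sum using (inj₁; inj₂)
open import Data.Product using (Σ; _,_)
open import Relation.Nullary using (¬_; Dec)
open import Relation.Binary.PropositionalEquality using (_≡_; refl; sym; subst; cong; module ≡-Reasoning)
open import Function.Base using (id)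
open import Function.Bundles using (_⇔_; mk⇔)

moves : {N : ℕ} → Game N → Fin N → ℕ
moves (mk n f) = n

option : {N : ℕ} (G : Game N) (i : Fin N) → Fin (moves G i) → Game N
option (mk n f) = f

-- Whether Left wins is decidable: games are finite.  Needed to extract a
-- refuting opponent move from the mere failure of Left to win.
leftWins? : {N : ℕ} (G : Game N) (p : Fin N) → Dec (LeftWins G p)
leftWins? (mk n f) zero    = any? (λ k → leftWins? (f zero k) (next zero))
leftWins? (mk n f) (suc q) = all? (λ k → leftWins? (f (suc q) k) (next (suc q)))

refutingOption : {N : ℕ} {n : Fin (suc N) → ℕ}
  (f : (i : Fin (suc N)) → Fin (n i) → Game (suc N)) (q : Fin N) →
  ¬ LeftWins (mk n f) (suc q) →
  Σ (Fin (n (suc q))) λ a → ¬ LeftWins (f (suc q) a) (next (suc q))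
refutingOption {n = n} f q notWin =
  ¬∀⟶∃¬ (n (suc q)) _ (λ k → leftWins? (f (suc q) k) (next (suc q))) notWin

option-⊕ˡ : {N : ℕ} {n m : Fin N → ℕ} (f : (i : Fin N) → Fin (n i) → Game N)
  (g : (i : Fin N) → Fin (m i) → Game N) (i : Fin N) (a : Fin (n i)) →
  option (mk n f ⊕ mk m g) i (a ↑ˡ m i) ≡ f i a ⊕ mk m g
option-⊕ˡ {n = n} {m} f g i a rewrite splitAt-↑ˡ (n i) a (m i) = refl

option-⊕ʳ : {N : ℕ} {n m : Fin N → ℕ} (f : (i : Fin N) → Fin (n i) → Game N)
  (g : (i : Fin N) → Fin (m i) → Game N) (i : Fin N) (b : Fin (m i)) →
  option (mk n f ⊕ mk m g) i (n i ↑ʳ b) ≡ mk n f ⊕ g i b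
option-⊕ʳ {n = n} {m} f g i b rewrite splitAt-↑ʳ (n i) (m i) b = refl

-- Consequently, a fact about some option of G ⊕ X is a fact about a sum
-- G^i ⊕ X or about a sum G ⊕ X^i: a move in a sum is a move in one summand.
-- (Stated as an eliminator, so that callers can recurse on the summands.)
option-⊕-elim : {N : ℕ} {n m : Fin N → ℕ} (f : (i : Fin N) → Fin (n i) → Game N)
  (g : (i : Fin N) → Fin (m i) → Game N) (P : Game N → Set) {R : Set} (i : Fin N)
  (k : Fin (n i + m i)) → P (option (mk n f ⊕ mk m g) i k) →
  ((a : Fin (n i)) → P (f i a ⊕ mk m g) → R) →
  ((b : Fin (m i)) → P (mk n f ⊕ g i b) → R) → R
option-⊕-elim {n = n} f g P i k holds inG inX with splitAt (n i) k
... | inj₁ a = inG a holds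
... | inj₂ b = inX b holds

leftWins-⊕zero : {N : ℕ} (G : Game N) (p : Fin N) →
  LeftWins G p → LeftWins (G ⊕ zeroG) p
leftWins-⊕zero (mk n f) zero (a , win) =
  a ↑ˡ 0 ,
  subst (λ H → LeftWins H (next zero)) (sym (option-⊕ˡ f _ zero a))
        (leftWins-⊕zero (f zero a) (next zero) win)
leftWins-⊕zero (mk n f) (suc q) win k with splitAt (n (suc q)) {0} k
... | inj₁ a = leftWins-⊕zero (f (suc q) a) (next (suc q)) (win a)
... | inj₂ ()

leftWins-zero⊕ : {N : ℕ} (X : Game N) (p : Fin N) →
  LeftWins X p → LeftWins (zeroG ⊕ X) p
leftWins-zero⊕ (mk m g) zero (b , win) =
  b , leftWins-zero⊕ (g zero b) (next zero) win
leftWins-zero⊕ (mk m g) (suc q) win b =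
  leftWins-zero⊕ (g (suc q) b) (next (suc q)) (win b)

mutual
  absorb : {N : ℕ} (G X : Game (suc N)) (p : Fin (suc N)) →
    ¬ LeftWins G zero → LeftWins (G ⊕ X) p → LeftWins X p
  absorb (mk n f) (mk m g) zero notWin (k , win) =
    option-⊕-elim f g (λ H → LeftWins H (next zero)) zero k win
      (λ a win′ → absorbAt (f zero a) (mk m g) (next zero) (λ w → notWin (a , w)) win′)
      (λ b win′ → b , absorb (mk n f) (g zero b) (next zero) notWin win′)
  absorb (mk n f) (mk m g) (suc q) notWin win b =
    absorb (mk n f) (g (suc q) b) (next (suc q)) notWin
      (subst (λ H → LeftWins H (next (suc q))) (option-⊕ʳ f g (suc q) b)
             (win (n (suc q) ↑ʳ b)))

  absorbAt : {N : ℕ} (G X : Game (suc N)) (q : Fin (suc N)) →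
    ¬ LeftWins G q → LeftWins (G ⊕ X) q → LeftWins X zero
  absorbAt G X zero notWin win = absorb G X zero notWin win
  absorbAt (mk n f) (mk m g) (suc q) notWin win
    with refutingOption f q notWin
  ... | a , notWinAfter =
    absorbAt (f (suc q) a) (mk m g) (next (suc q)) notWinAfter
      (subst (λ H → LeftWins H (next (suc q))) (option-⊕ˡ f g (suc q) a)
             (win (a ↑ˡ m (suc q))))

firstMover : (n : ℕ) → fromℕ< (m%n<n (suc n + 1 ∸ 1) (suc n)) ≡ zero
firstMover n = toℕ-injective (begin
  toℕ (fromℕ< (m%n<n (suc n + 1 ∸ 1) (suc n))) ≡⟨ toℕ-fromℕ< (m%n<n (n + 1) (suc n)) ⟩
  (n + 1) % suc n                               ≡⟨ cong (_% suc n) (+-comm n 1) ⟩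
  suc n % suc n                                 ≡⟨ n%n≡0 (suc n) ⟩
  0                                             ∎)
  where open ≡-Reasoning

leftWinsMovingFirst : {n : ℕ} (G : Game (suc n)) →
  LeftWinsMoving G 1 ≡ LeftWins G zero
leftWinsMovingFirst {n} G = cong (LeftWins G) (firstMover n)

zeroSum-leftLoses : {n : ℕ} → ¬ LeftWins (zeroG {suc n} ⊕ zeroG) zero
zeroSum-leftLoses (() , _)

mainTheorem13 : (N : ℕ) → 2 ≤ N → (G : Game N) →
    (G ≤L zeroG) ⇔ (¬ LeftWinsMoving G 1)
mainTheorem13 zero () G
mainTheorem13 (suc n) _ G = mk⇔ onlyIf if
  where
  onlyIf : G ≤L zeroG → ¬ LeftWinsMoving G 1
  onlyIf G≤0 win = zeroSum-leftLoses
    (subst id (leftWinsMovingFirst (zeroG ⊕ zeroG))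
      (G≤0 zeroG 1 (s≤s z≤n) (s≤s z≤n) (leftWins-⊕zero G _ win)))

  if : ¬ LeftWinsMoving G 1 → G ≤L zeroG
  if notWin X i _ _ win =
    leftWins-zero⊕ X _ (absorb G X _ (subst ¬_ (leftWinsMovingFirst G) notWin) win)
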